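{- For any constant specification $\mathsf{CS}$ for $\mathsf{JE}$, the logic $\mathsf{JE}_{\mathsf{CS}}$ is consistent, i.e. $\mathsf{JE}_{\mathsf{CS}}\nvdash\bot$.
   Context: Fix countably many proof constants $\alpha_i$, proof variables $\xi_i$, and a countable set $\mathsf{Prop}$ of atomic propositions. Proof terms: $\lambda ::= \alpha_i \mid \xi_i \mid (\lambda\cdot\lambda) \mid (\lambda+\lambda) \mid\ !\lambda$. Justification terms: $t ::= \mathsf{e}(\lambda)$. Formulas: $F ::= P\mid\bot\mid(F\to F)\mid\lambda:F\mid[t]F$; other connectives are classical abbreviations. Axioms of $\mathsf{JE}$: all instances of classical propositional tautologies and of (j) $\lambda:(F\to G)\to(\kappa:F\to\lambda\cdot\kappa:G)$; (j+$_1$) $(\lambda:F\vee\kappa:F)\to(\lambda+\kappa):F$; (jt) $\lambda:F\to F$; (j4) $\lambda:F\to\ !\lambda:\lambda:F$; (je) $(\lambda:(F\to G)\wedge\lambda:(G\to F))\to([\mathsf{e}(\lambda)]F\to[\mathsf{e}(\lambda)]G)$; (je+) $([\mathsf{e}(\lambda)]F\vee[\mathsf{e}(\kappa)]F)\to[\mathsf{e}(\lambda+\kappa)]F$. A constant specification $\mathsf{CS}$ is a set of pairs $(\alpha,A)$, $\alpha$ a proof constant, $A$ an axiom of $\mathsf{JE}$. $\mathsf{JE}_{\mathsf{CS}}$ is the Hilbert system with these axioms, modus ponens, and axiom necessitation (infer $\alpha:A$ whenever $(\alpha,A)\in\mathsf{CS}$). -}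

module Defs where

open import Data.Nat using (ℕ)
open import Data.Bool using (Bool; true; false; _∨_; not)
open import Data.Product using (_×_; Σ)
open import Relation.Binary.PropositionalEquality using (_≡_)
open import Level using (Level; suc; _⊔_)

data PTerm : Set where
  const : ℕ → PTerm
  var   : ℕ → PTerm
  _·_   : PTerm → PTerm → PTerm
  _⊕_   : PTerm → PTerm → PTerm
  !_    : PTerm → PTerm

data JTerm : Set where
  e : PTerm → JTerm

data Fm : Set where
  atom  : ℕ → Fm
  fls   : Fm
  _⇒_   : Fm → Fm → Fm
  _∶_   : PTerm → Fm → Fm
  [_]_  : JTerm → Fm → Fm

infixr 5 _⇒_

¬ᶠ_ : Fm → Fm
¬ᶠ A = A ⇒ fls

_∨ᶠ_ : Fm → Fm → Fm
A ∨ᶠ B = (¬ᶠ A) ⇒ B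

_∧ᶠ_ : Fm → Fm → Fm
A ∧ᶠ B = ¬ᶠ (A ⇒ ¬ᶠ B)

-- Boolean evaluation, where the "prime" formulas (atoms, λ:F, [t]F) get
-- arbitrary truth values given by v.
eval : (Fm → Bool) → Fm → Bool
eval v (atom p)  = v (atom p)
eval v fls       = false
eval v (A ⇒ B)   = not (eval v A) ∨ eval v B
eval v (s ∶ A)   = v (s ∶ A)
eval v ([ t ] A) = v ([ t ] A)

Taut : Fm → Set
Taut A = (v : Fm → Bool) → eval v A ≡ true

data Axiom : Fm → Set where
  ax-taut : ∀ {A} → Taut A → Axiom A
  ax-j    : ∀ l k F G → Axiom ((l ∶ (F ⇒ G)) ⇒ ((k ∶ F) ⇒ ((l · k) ∶ G)))
  ax-j+   : ∀ l k F → Axiom (((l ∶ F) ∨ᶠ (k ∶ F)) ⇒ ((l ⊕ k) ∶ F))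
  ax-jt   : ∀ l F → Axiom ((l ∶ F) ⇒ F)
  ax-j4   : ∀ l F → Axiom ((l ∶ F) ⇒ ((! l) ∶ (l ∶ F)))
  ax-je   : ∀ l F G → Axiom (((l ∶ (F ⇒ G)) ∧ᶠ (l ∶ (G ⇒ F)))
                               ⇒ (([ e l ] F) ⇒ ([ e l ] G)))
  ax-je+  : ∀ l k F → Axiom ((([ e l ] F) ∨ᶠ ([ e k ] F)) ⇒ ([ e (l ⊕ k) ] F))

record ConstSpec (ℓ : Level) : Set (suc ℓ) where
  field
    _∋_      : ℕ → Fm → Set ℓ
    isAxiom  : ∀ {i A} → _∋_ i A → Axiom A

data _⊢_ {ℓ : Level} (CS : ConstSpec ℓ) : Fm → Set ℓ where
  axiom : ∀ {A} → Axiom A → CS ⊢ A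
  mp    : ∀ {A B} → CS ⊢ (A ⇒ B) → CS ⊢ A → CS ⊢ B
  an    : ∀ {i A} → ConstSpec._∋_ CS i A → CS ⊢ (const i ∶ A)

{-# OPTIONS --safe #-}
-- Forget the justification structure: read λ:F as F and [t]F as ⊤. Under this
-- Boolean interpretation every axiom of JE is true ((je) and (je+) because
-- their consequents [t]G are), and modus ponens preserves truth, so ⊥ is not
-- derivable whatever the constant specification.
module Submission where

open import Defs
open import Level using (Level)
open import Relation.Nullary using (¬_)
open import Data.Bool using (Bool; true; false; _∨_; not)
open import Data.Bool.Properties using (∨-inverseˡ; ∨-zeroʳ)
open import Relation.Binary.PropositionalEquality using (_≡_; refl; cong₂; trans; sym)

⟦_⟧ : Fm → Bool
⟦ atom p ⟧  = false
⟦ fls ⟧     = false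
⟦ A ⇒ B ⟧   = not ⟦ A ⟧ ∨ ⟦ B ⟧
⟦ s ∶ A ⟧   = ⟦ A ⟧
⟦ [ t ] A ⟧ = true

eval-⟦⟧ : ∀ A → eval ⟦_⟧ A ≡ ⟦ A ⟧
eval-⟦⟧ (atom p)  = refl
eval-⟦⟧ fls       = refl
eval-⟦⟧ (A ⇒ B)   = cong₂ (λ a b → not a ∨ b) (eval-⟦⟧ A) (eval-⟦⟧ B)
eval-⟦⟧ (s ∶ A)   = refl
eval-⟦⟧ ([ t ] A) = refl

Taut⇒⟦⟧ : ∀ {A} → Taut A → ⟦ A ⟧ ≡ true
Taut⇒⟦⟧ {A} taut = trans (sym (eval-⟦⟧ A)) (taut ⟦_⟧)

Axiom⇒⟦⟧ : ∀ {A} → Axiom A → ⟦ A ⟧ ≡ true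
Axiom⇒⟦⟧ (ax-taut {A} taut) = Taut⇒⟦⟧ {A} taut
Axiom⇒⟦⟧ (ax-j l k F G)     = ∨-inverseˡ (not ⟦ F ⟧ ∨ ⟦ G ⟧)
Axiom⇒⟦⟧ (ax-j+ l k F) with ⟦ F ⟧
... | true  = refl
... | false = refl
Axiom⇒⟦⟧ (ax-jt l F)        = ∨-inverseˡ ⟦ F ⟧
Axiom⇒⟦⟧ (ax-j4 l F)        = ∨-inverseˡ ⟦ F ⟧
Axiom⇒⟦⟧ (ax-je l F G)      = ∨-zeroʳ (not ⟦ (l ∶ (F ⇒ G)) ∧ᶠ (l ∶ (G ⇒ F)) ⟧)
Axiom⇒⟦⟧ (ax-je+ l k F)     = ∨-zeroʳ (not ⟦ ([ e l ] F) ∨ᶠ ([ e k ] F) ⟧)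

⇒-true-mp : ∀ {a b} → not a ∨ b ≡ true → a ≡ true → b ≡ true
⇒-true-mp a⇒b refl = a⇒b

⊢⇒⟦⟧ : ∀ {ℓ} {CS : ConstSpec ℓ} {A} → CS ⊢ A → ⟦ A ⟧ ≡ true
⊢⇒⟦⟧ (axiom ax)         = Axiom⇒⟦⟧ ax
⊢⇒⟦⟧ (mp ⊢A⇒B ⊢A)       = ⇒-true-mp (⊢⇒⟦⟧ ⊢A⇒B) (⊢⇒⟦⟧ ⊢A)
⊢⇒⟦⟧ {CS = CS} (an i∋A) = Axiom⇒⟦⟧ (ConstSpec.isAxiom CS i∋A)

mainTheorem9 : ∀ {ℓ : Level} (CS : ConstSpec ℓ) → ¬ (CS ⊢ fls)
mainTheorem9 CS ⊢fls with ⊢⇒⟦⟧ ⊢fls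
... | ()
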